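{- Let $\mathcal{T}=\{T_1,\dots,T_t\}$ be a set of unrooted binary phylogenetic trees on the same leaf set $X$, with $n = |X|$. Then the LP $$\text{Minimize } \sum_{e \in E(T_1)} x_e \quad \text{s.t. } \sum_{e \in L(Q)} x_e \ge 1 \ \ \forall Q \in \mathcal{Q}, \qquad x_e \ge 0 \ \ \forall e \in E(T_1)$$ has a feasible solution $\tilde x$ with $\sum_{e \in E(T_1)} \tilde x_e = n/4$.
   Context: A phylogenetic tree on $X$ is an unrooted tree with all internal vertices of degree 3 and leaves bijectively labelled by $X$. For $Y\subseteq X$, $T[Y]$ is the minimal subtree connecting $Y$, and $T|_Y$ is $T[Y]$ with degree-2 vertices suppressed; trees on the same labels are isomorphic ($\cong$) if there is a label-preserving graph isomorphism. A quartet is a 4-element subset of $X$; for $Q = \{a,b,c,d\}$, $ab|cd$ is the tree on $Q$ where $a,b$ share a neighbour, $c,d$ share a neighbour, and these two neighbours are adjacent. If $T_1|_Q \cong ab|cd$, $L(Q)$ is the edge set of $T_1[\{a,b\}] \cup T_1[\{c,d\}]$. $\mathcal{Q}$ is the set of quartets $Q$ such that $T_1|_Q \not\cong T_i|_Q$ for some $2 \le i \le t$. -}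

module Defs where

open import Data.Nat using (ℕ; suc)
open import Data.Fin using (Fin)
open import Data.Fin.Properties using () renaming (_≟_ to _≟ᶠ_)
open import Data.List using (List; []; _∷_; length; filter; map; foldr; allFin)
open import Data.List.Membership.Propositional using (_∈_)
open import Data.List.Relation.Unary.Unique.Propositional using (Unique)
open import Data.Product using (Σ; ∃; _×_; _,_; proj₁; proj₂)
open import Data.Sum using (_⊎_)
open import Data.Empty using (⊥)
open import Relation.Nullary using (¬_)
open import Relation.Nullary.Decidable using (_⊎-dec_)
open import Relation.Binary.PropositionalEquality using (_≡_; _≢_)
open import Function.Definitions using (Injective)
open import Data.Rational using (ℚ; 0ℚ; _+_)

Joins : {m E : ℕ} → (Fin E → Fin m × Fin m) → Fin E → Fin m → Fin m → Set
Joins ends k u w = (ends k ≡ (u , w)) ⊎ (ends k ≡ (w , u))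

data Walk {m E : ℕ} (ends : Fin E → Fin m × Fin m) : Fin m → Fin m → Set where
  here : (u : Fin m) → Walk ends u u
  step : {u w v : Fin m} (k : Fin E) → Joins ends k u w → Walk ends w v → Walk ends u v

module _ {m E : ℕ} {ends : Fin E → Fin m × Fin m} where
  walkVertices : {u v : Fin m} → Walk ends u v → List (Fin m)
  walkVertices (here u) = u ∷ []
  walkVertices (step {u = u} k _ p) = u ∷ walkVertices p

  walkEdges : {u v : Fin m} → Walk ends u v → List (Fin E)
  walkEdges (here u) = []
  walkEdges (step k _ p) = k ∷ walkEdges p

IsPath : {m E : ℕ} {ends : Fin E → Fin m × Fin m} {u v : Fin m} → Walk ends u v → Set
IsPath p = Unique (walkVertices p)

-- degree of a vertex (number of incident edges; graphs are loopless)
degree : {m E : ℕ} → (Fin E → Fin m × Fin m) → Fin m → ℕ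
degree ends v =
  length (filter (λ k → (proj₁ (ends k) ≟ᶠ v) ⊎-dec (proj₂ (ends k) ≟ᶠ v)) (allFin _))

record PhyloTree (n : ℕ) : Set where
  field
    m      : ℕ
    E      : ℕ
    ends   : Fin E → Fin m × Fin m
    leaf   : Fin n → Fin m
    loopless : ∀ k → proj₁ (ends k) ≢ proj₂ (ends k)
    noMulti  : ∀ k k' u w → Joins ends k u w → Joins ends k' u w → k ≡ k'
    -- tree: connected with |E| = |V| - 1
    connected : ∀ u v → Walk ends u v
    treeCount : suc E ≡ m
    -- labelling is a bijection onto the leaves (degree-1 vertices),
    -- and all internal vertices have degree 3
    leafInj    : Injective _≡_ _≡_ leaf
    leafDeg    : ∀ x → degree ends (leaf x) ≡ 1
    internalDeg : ∀ v → (∀ x → leaf x ≢ v) → degree ends v ≡ 3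

open PhyloTree public

-- edge k of T lies in T[{a,b}] (the unique path between leaves a and b)
InSpanE : {n : ℕ} (T : PhyloTree n) → Fin n → Fin n → Fin (E T) → Set
InSpanE T a b k =
  Σ (Walk (ends T) (leaf T a) (leaf T b)) λ p → IsPath p × (k ∈ walkEdges p)

InSpanV : {n : ℕ} (T : PhyloTree n) → Fin n → Fin n → Fin (m T) → Set
InSpanV T a b w =
  Σ (Walk (ends T) (leaf T a) (leaf T b)) λ p → IsPath p × (w ∈ walkVertices p)

-- T|{a,b,c,d} ≅ ab|cd  (for distinct a b c d), via: T[{a,b}] and T[{c,d}]
-- are vertex-disjoint
Displays : {n : ℕ} (T : PhyloTree n) → Fin n → Fin n → Fin n → Fin n → Set
Displays T a b c d = ∀ w → InSpanV T a b w → InSpanV T c d w → ⊥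

-- edge k of T lies in L(Q) = E(T[{a,b}] ∪ T[{c,d}])
InL : {n : ℕ} (T : PhyloTree n) → Fin n → Fin n → Fin n → Fin n → Fin (E T) → Set
InL T a b c d k = InSpanE T a b k ⊎ InSpanE T c d k

Distinct4 : {n : ℕ} → Fin n → Fin n → Fin n → Fin n → Set
Distinct4 a b c d = a ≢ b × a ≢ c × a ≢ d × b ≢ c × b ≢ d × c ≢ d

Σℚ : List ℚ → ℚ
Σℚ = foldr _+_ 0ℚ

{-# OPTIONS --safe #-}

-- Give every edge of T₁ the weight (number of leaves it ends in)/4, i.e. 1/4 on pendant
-- edges and 0 on internal ones. Each leaf lies on exactly one edge, so the weights add
-- up to n/4. For a quartet ab|cd the paths T₁[{a,b}] and T₁[{c,d}] start and end at the
-- four distinct leaves, so L(Q) contains their four pendant edges and has weight at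
-- least 1. Both counts are double countings of the leaf-edge incidences.

module Submission where

open import Defs
open import Data.Nat using (ℕ)
open import Data.Fin using (Fin)
open import Data.List using (List; map; allFin)
open import Data.List.Membership.Propositional using (_∈_)
open import Data.List.Relation.Unary.Unique.Propositional using (Unique)
open import Data.List.Relation.Unary.Any using (Any)
open import Data.Product using (Σ; _×_)
open import Data.Integer using (+_)
open import Data.Rational using (ℚ; 0ℚ; 1ℚ; _≤_; _/_)
open import Function.Bundles using (_⇔_)
open import Relation.Binary.PropositionalEquality using (_≡_)
open import Relation.Nullary using (¬_)

open import Algebra.Properties.CommutativeSemigroup using (interchange)
open import Data.Bool using (if_then_else_)
open import Data.Empty using (⊥-elim)
open import Data.Fin.Properties using (_≟_)
open import Data.Integer as ℤ using (+≤+)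
import Data.Integer.Properties as ℤ
open import Data.Integer.Solver using (module +-*-Solver)
open import Data.List using ([]; _∷_; length; filter)
open import Data.List.Membership.Propositional using (_∉_)
open import Data.List.Membership.Propositional.Properties using (∈-map⁺; ∈-allFin)
open import Data.List.Properties using (map-cong; map-cong-local; map-∘; length-tabulate)
open import Data.List.Relation.Unary.All as All using (All; []; _∷_)
open import Data.List.Relation.Unary.All.Properties.Core using (All¬⇒¬Any; ¬Any⇒All¬)
open import Data.List.Relation.Unary.AllPairs using ([]; _∷_)
open import Data.List.Relation.Unary.Any using (here; there)
open import Data.List.Relation.Unary.Unique.Propositional.Properties using (allFin⁺)
open import Data.Nat as ℕ using (suc; _+_; _*_; z≤n)
open import Data.Nat.ListAction using (sum)
open import Data.Nat.Properties as ℕ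
  using (+-mono-≤; m≤m+n; m≤n+m; ≤-trans; ≤-reflexive; *-zeroʳ; *-identityʳ; +-commutativeSemigroup)
open import Data.Product using (∃; _,_; proj₁; proj₂)
open import Data.Rational using (toℚᵘ) renaming (_+_ to _+ℚ_)
import Data.Rational.Properties as ℚ
open import Data.Rational.Properties using (toℚᵘ-injective; toℚᵘ-homo-+; toℚᵘ-fromℚᵘ; toℚᵘ-cancel-≤)
import Data.Rational.Unnormalised as ℚᵘ
import Data.Rational.Unnormalised.Properties as ℚᵘ
open import Data.Sum using (_⊎_; inj₁; inj₂)
open import Function using (_∘_; id)
open import Function.Bundles using (module Equivalence)
open import Relation.Binary.Definitions using (DecidableEquality)
open import Relation.Binary.PropositionalEquality using (_≢_; refl; sym; trans; cong)
open import Relation.Nullary using (Dec; yes; no; does)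
open import Relation.Nullary.Decidable using (_⊎-dec_; dec-true)
open import Relation.Unary using (Pred; Decidable)

indicator : ∀ {p} {P : Set p} → Dec P → ℕ
indicator P? = if does P? then 1 else 0

indicator-yes : ∀ {p} {P : Set p} (P? : Dec P) → P → indicator P? ≡ 1
indicator-yes P? p rewrite dec-true P? p = refl

module _ {a} {A : Set a} where

  sum-map-+ : ∀ (f g : A → ℕ) xs → sum (map (λ x → f x + g x) xs) ≡ sum (map f xs) + sum (map g xs)
  sum-map-+ f g [] = refl
  sum-map-+ f g (x ∷ xs) = trans (cong (λ s → f x + g x + s) (sum-map-+ f g xs))
    (interchange +-commutativeSemigroup (f x) (g x) (sum (map f xs)) (sum (map g xs)))

  sum-map-const : ∀ c (xs : List A) → sum (map (λ _ → c) xs) ≡ length xs * c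
  sum-map-const c [] = refl
  sum-map-const c (x ∷ xs) = cong (λ s → c + s) (sum-map-const c xs)

  sum-map-mono-≤ : ∀ {f g : A → ℕ} → (∀ x → f x ℕ.≤ g x) → ∀ xs → sum (map f xs) ℕ.≤ sum (map g xs)
  sum-map-mono-≤ f≤g [] = z≤n
  sum-map-mono-≤ f≤g (x ∷ xs) = +-mono-≤ (f≤g x) (sum-map-mono-≤ f≤g xs)

  length-filter≡sum-indicator : ∀ {p} {P : Pred A p} (P? : Decidable P) xs →
    length (filter P? xs) ≡ sum (map (λ x → indicator (P? x)) xs)
  length-filter≡sum-indicator P? [] = refl
  length-filter≡sum-indicator P? (x ∷ xs) with P? x
  ... | yes _ = cong suc (length-filter≡sum-indicator P? xs)
  ... | no  _ = length-filter≡sum-indicator P? xs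

∈⇒≤sum : ∀ {n ns} → n ∈ ns → n ℕ.≤ sum ns
∈⇒≤sum {ns = n ∷ ns} (here refl)    = m≤m+n n (sum ns)
∈⇒≤sum {ns = m ∷ ns} (there n∈ns) = ≤-trans (∈⇒≤sum n∈ns) (m≤n+m (sum ns) m)

sum-map-comm : ∀ {a b} {A : Set a} {B : Set b} (f : A → B → ℕ) xs ys →
  sum (map (λ x → sum (map (f x) ys)) xs) ≡ sum (map (λ y → sum (map (λ x → f x y) xs)) ys)
sum-map-comm f [] ys = sym (trans (sum-map-const 0 ys) (*-zeroʳ (length ys)))
sum-map-comm f (x ∷ xs) ys = trans (cong (λ s → sum (map (f x) ys) + s) (sum-map-comm f xs ys))
  (sym (sum-map-+ (f x) (λ y → sum (map (λ x → f x y) xs)) ys))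

module Occurrences {a} {A : Set a} (_≟ᴬ_ : DecidableEquality A) where
  open import Data.List.Membership.DecPropositional _≟ᴬ_ using (_∈?_)

  occurrences : A → List A → ℕ
  occurrences y xs = sum (map (λ x → indicator (x ≟ᴬ y)) xs)

  occurrences-∉ : ∀ {y} xs → y ∉ xs → occurrences y xs ≡ 0
  occurrences-∉ [] _ = refl
  occurrences-∉ {y} (x ∷ xs) y∉x∷xs with x ≟ᴬ y
  ... | yes refl = ⊥-elim (y∉x∷xs (here refl))
  ... | no  _    = occurrences-∉ xs (y∉x∷xs ∘ there)

  occurrences-unique : ∀ {y xs} → Unique xs → y ∈ xs → occurrences y xs ≡ 1
  occurrences-unique {xs = x ∷ xs} (x∉xs ∷ _) (here refl) with x ≟ᴬ x
  ... | yes _   = cong suc (occurrences-∉ xs (All¬⇒¬Any x∉xs))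
  ... | no  x≢x = ⊥-elim (x≢x refl)
  occurrences-unique {y} {x ∷ xs} (x∉xs ∷ xs!) (there y∈xs) with x ≟ᴬ y
  ... | yes refl = ⊥-elim (All¬⇒¬Any x∉xs y∈xs)
  ... | no  _    = occurrences-unique xs! y∈xs

  indicator-≟-sym : ∀ x y → indicator (x ≟ᴬ y) ≡ indicator (y ≟ᴬ x)
  indicator-≟-sym x y with x ≟ᴬ y | y ≟ᴬ x
  ... | yes _   | yes _   = refl
  ... | no  _   | no  _   = refl
  ... | yes x≡y | no  y≢x = ⊥-elim (y≢x (sym x≡y))
  ... | no  x≢y | yes y≡x = ⊥-elim (x≢y (sym y≡x))

  -- Double counting of the pairs x ≡ y with x ∈ xs and y ∈ ys.
  length≤sum-map : ∀ {ys xs} (g : A → ℕ) → Unique ys → Unique xs → All (_∈ xs) ys →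
    All (λ y → 1 ℕ.≤ g y) ys → length ys ℕ.≤ sum (map g xs)
  length≤sum-map {ys} {xs} g ys! xs! ys⊆xs g≥1 = begin
    length ys                                                    ≡⟨ *-identityʳ (length ys) ⟨
    length ys * 1                                                ≡⟨ sum-map-const 1 ys ⟨
    sum (map (λ _ → 1) ys)                                       ≡⟨ cong sum (map-cong-local (All.map occurs-once-in-xs ys⊆xs)) ⟨
    sum (map (λ y → sum (map (λ x → indicator (y ≟ᴬ x)) xs)) ys) ≡⟨ sum-map-comm (λ x y → indicator (y ≟ᴬ x)) xs ys ⟨
    sum (map (λ x → occurrences x ys) xs)                        ≤⟨ sum-map-mono-≤ occurrences≤g xs ⟩
    sum (map g xs)                                               ∎
    where
    open ℕ.≤-Reasoning
    occurs-once-in-xs : ∀ {y} → y ∈ xs → sum (map (λ x → indicator (y ≟ᴬ x)) xs) ≡ 1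
    occurs-once-in-xs {y} y∈xs = trans (cong sum (map-cong (indicator-≟-sym y) xs)) (occurrences-unique xs! y∈xs)
    occurrences≤g : ∀ x → occurrences x ys ℕ.≤ g x
    occurrences≤g x with x ∈? ys
    ... | yes x∈ys = ≤-trans (≤-reflexive (occurrences-unique ys! x∈ys)) (All.lookup g≥1 x∈ys)
    ... | no  x∉ys = ≤-trans (≤-reflexive (occurrences-∉ ys x∉ys)) z≤n

quarter : ℕ → ℚ
quarter n = + n / 4

quarterᵘ : ∀ n → toℚᵘ (quarter n) ℚᵘ.≃ ℚᵘ.mkℚᵘ (+ n) 3
quarterᵘ n = toℚᵘ-fromℚᵘ (ℚᵘ.mkℚᵘ (+ n) 3)

quarter-+ : ∀ m n → quarter m +ℚ quarter n ≡ quarter (m + n)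
quarter-+ m n = toℚᵘ-injective (begin
  toℚᵘ (quarter m +ℚ quarter n)           ≈⟨ toℚᵘ-homo-+ (quarter m) (quarter n) ⟩
  toℚᵘ (quarter m) ℚᵘ.+ toℚᵘ (quarter n) ≈⟨ ℚᵘ.+-cong (quarterᵘ m) (quarterᵘ n) ⟩
  ℚᵘ.mkℚᵘ (+ m) 3 ℚᵘ.+ ℚᵘ.mkℚᵘ (+ n) 3   ≈⟨ ℚᵘ.*≡* cross-multiplied ⟩
  ℚᵘ.mkℚᵘ (+ (m + n)) 3                  ≈⟨ quarterᵘ (m + n) ⟨
  toℚᵘ (quarter (m + n))                 ∎)
  where
  open ℚᵘ.≃-Reasoning
  open +-*-Solver
  cross-multiplied : (+ m ℤ.* + 4 ℤ.+ + n ℤ.* + 4) ℤ.* + 4 ≡ + (m + n) ℤ.* + 16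
  cross-multiplied rewrite ℤ.pos-+ m n =
    solve 2 (λ p q → (p :* con (+ 4) :+ q :* con (+ 4)) :* con (+ 4) := (p :+ q) :* con (+ 16)) refl (+ m) (+ n)

quarter-mono-≤ : ∀ {m n} → m ℕ.≤ n → quarter m ≤ quarter n
quarter-mono-≤ {m} {n} m≤n = toℚᵘ-cancel-≤
  (ℚᵘ.≤-respˡ-≃ (ℚᵘ.≃-sym (quarterᵘ m)) (ℚᵘ.≤-respʳ-≃ (ℚᵘ.≃-sym (quarterᵘ n))
    (ℚᵘ.*≤* (ℤ.*-monoʳ-≤-nonNeg (+ 4) (+≤+ m≤n)))))

Σℚ-map-quarter : ∀ ns → Σℚ (map quarter ns) ≡ quarter (sum ns)
Σℚ-map-quarter [] = refl
Σℚ-map-quarter (n ∷ ns) = trans (cong (λ q → quarter n +ℚ q) (Σℚ-map-quarter ns)) (quarter-+ n (sum ns))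

module _ {m E : ℕ} (ends : Fin E → Fin m × Fin m) where
  open import Data.List.Membership.DecPropositional (_≟_ {m}) using (_∈?_)

  Incident : Fin E → Fin m → Set
  Incident k v = proj₁ (ends k) ≡ v ⊎ proj₂ (ends k) ≡ v

  incident? : ∀ k v → Dec (Incident k v)
  incident? k v = (proj₁ (ends k) ≟ v) ⊎-dec (proj₂ (ends k) ≟ v)

  joins⇒incidentˡ : ∀ {k u w} → Joins ends k u w → Incident k u
  joins⇒incidentˡ (inj₁ refl) = inj₁ refl
  joins⇒incidentˡ (inj₂ refl) = inj₂ refl

  joins⇒incidentʳ : ∀ {k u w} → Joins ends k u w → Incident k w
  joins⇒incidentʳ (inj₁ refl) = inj₂ refl
  joins⇒incidentʳ (inj₂ refl) = inj₁ refl

  Path : Fin m → Fin m → Set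
  Path u v = Σ (Walk ends u v) IsPath

  path-suffix : ∀ {u w v} (p : Walk ends w v) → IsPath p → u ∈ walkVertices p → Path u v
  path-suffix (here w)     p!       (here refl)  = here w , p!
  path-suffix (step k j p) p!       (here refl)  = step k j p , p!
  path-suffix (step k j p) (_ ∷ p!) (there u∈p) = path-suffix p p! u∈p

  walk⇒path : ∀ {u v} → Walk ends u v → Path u v
  walk⇒path (here u) = here u , [] ∷ []
  walk⇒path {u} (step k j p) with walk⇒path p
  ... | p′ , p′! with u ∈? walkVertices p′
  ...   | yes u∈p′ = path-suffix p′ p′! u∈p′
  ...   | no  u∉p′ = step k j p′ , ¬Any⇒All¬ _ u∉p′ ∷ p′!

  incident-edge-at-start : ∀ {u v} → u ≢ v → (p : Walk ends u v) →
    ∃ λ k → k ∈ walkEdges p × Incident k u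
  incident-edge-at-start u≢u (here _)     = ⊥-elim (u≢u refl)
  incident-edge-at-start _   (step k j _) = k , here refl , joins⇒incidentˡ j

  incident-edge-at-end : ∀ {u v} → u ≢ v → (p : Walk ends u v) →
    ∃ λ k → k ∈ walkEdges p × Incident k v
  incident-edge-at-end u≢u (here _)     = ⊥-elim (u≢u refl)
  incident-edge-at-end _   (step k j p) = last-edge k j p
    where
    last-edge : ∀ {u w v} k (j : Joins ends k u w) (p : Walk ends w v) →
      ∃ λ k′ → k′ ∈ walkEdges (step k j p) × Incident k′ v
    last-edge k j (here _)       = k , here refl , joins⇒incidentʳ j
    last-edge k j (step k′ j′ p) with last-edge k′ j′ p
    ... | k″ , k″∈p , k″-v = k″ , there k″∈p , k″-v

module _ {n : ℕ} (T : PhyloTree n) where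

  incidence : Fin (E T) → Fin n → ℕ
  incidence k x = indicator (incident? (ends T) k (leaf T x))

  leafCount : Fin (E T) → ℕ
  leafCount k = sum (map (incidence k) (allFin n))

  sum-leafCount : sum (map leafCount (allFin (E T))) ≡ n
  sum-leafCount = begin
    sum (map leafCount (allFin (E T)))                                  ≡⟨ sum-map-comm incidence (allFin (E T)) (allFin n) ⟩
    sum (map (λ x → sum (map (λ k → incidence k x) (allFin (E T)))) (allFin n)) ≡⟨ cong sum (map-cong leaf-degree (allFin n)) ⟩
    sum (map (λ _ → 1) (allFin n))                                      ≡⟨ sum-map-const 1 (allFin n) ⟩
    length (allFin n) * 1                                               ≡⟨ *-identityʳ _ ⟩
    length (allFin n)                                                   ≡⟨ length-tabulate id ⟩
    n                                                                   ∎
    where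
    open Relation.Binary.PropositionalEquality.≡-Reasoning
    leaf-degree : ∀ x → sum (map (λ k → incidence k x) (allFin (E T))) ≡ 1
    leaf-degree x = trans (sym (length-filter≡sum-indicator (λ k → incident? (ends T) k (leaf T x)) (allFin (E T))))
                          (leafDeg T x)

  span-edge-at-leafˡ : ∀ {a b} → a ≢ b → ∃ λ k → InSpanE T a b k × Incident (ends T) k (leaf T a)
  span-edge-at-leafˡ {a} {b} a≢b with walk⇒path (ends T) (connected T (leaf T a) (leaf T b))
  ... | p , p! with incident-edge-at-start (ends T) (a≢b ∘ leafInj T) p
  ... | k , k∈p , k-a = k , (p , p! , k∈p) , k-a

  span-edge-at-leafʳ : ∀ {a b} → a ≢ b → ∃ λ k → InSpanE T a b k × Incident (ends T) k (leaf T b)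
  span-edge-at-leafʳ {a} {b} a≢b with walk⇒path (ends T) (connected T (leaf T a) (leaf T b))
  ... | p , p! with incident-edge-at-end (ends T) (a≢b ∘ leafInj T) p
  ... | k , k∈p , k-b = k , (p , p! , k∈p) , k-b

  length≤sum-leafCount : ∀ {ys} es → Unique ys →
    All (λ y → ∃ λ k → k ∈ es × Incident (ends T) k (leaf T y)) ys → length ys ℕ.≤ sum (map leafCount es)
  length≤sum-leafCount {ys} es ys! ys-touch-es = begin
    length ys                     ≤⟨ Occurrences.length≤sum-map _≟_ edgesAt ys! (allFin⁺ n) all∈allFin
                                       (All.map edgesAt≥1 ys-touch-es) ⟩
    sum (map edgesAt (allFin n))  ≡⟨ sum-map-comm incidence es (allFin n) ⟨
    sum (map leafCount es)        ∎
    where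
    open ℕ.≤-Reasoning
    edgesAt : Fin n → ℕ
    edgesAt x = sum (map (λ k → incidence k x) es)
    all∈allFin : All (_∈ allFin n) ys
    all∈allFin = All.tabulate (λ _ → ∈-allFin _)
    edgesAt≥1 : ∀ {y} → (∃ λ k → k ∈ es × Incident (ends T) k (leaf T y)) → 1 ℕ.≤ edgesAt y
    edgesAt≥1 {y} (k , k∈es , k-y) = ≤-trans (≤-reflexive (sym (indicator-yes (incident? (ends T) k (leaf T y)) k-y)))
                                              (∈⇒≤sum (∈-map⁺ (λ k → incidence k y) k∈es))

  quartet-leafCount : ∀ {a b c d} es → Distinct4 a b c d → (∀ {k} → InL T a b c d k → k ∈ es) →
    4 ℕ.≤ sum (map leafCount es)
  quartet-leafCount {a} {b} {c} {d} es (a≢b , a≢c , a≢d , b≢c , b≢d , c≢d) L⊆es =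
    length≤sum-leafCount es abcd!
      ( in-es inj₁ (span-edge-at-leafˡ a≢b) ∷ in-es inj₁ (span-edge-at-leafʳ a≢b)
      ∷ in-es inj₂ (span-edge-at-leafˡ c≢d) ∷ in-es inj₂ (span-edge-at-leafʳ c≢d) ∷ [])
    where
    abcd! : Unique (a ∷ b ∷ c ∷ d ∷ [])
    abcd! = (a≢b ∷ a≢c ∷ a≢d ∷ []) ∷ (b≢c ∷ b≢d ∷ []) ∷ (c≢d ∷ []) ∷ [] ∷ []
    in-es : ∀ {y} {S : Fin (E T) → Set} → (∀ {k} → S k → InL T a b c d k) →
      (∃ λ k → S k × Incident (ends T) k (leaf T y)) → ∃ λ k → k ∈ es × Incident (ends T) k (leaf T y)
    in-es S⊆L (k , k∈S , k-y) = k , L⊆es (S⊆L k∈S) , k-y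

lemma7 : (n : ℕ) (T₁ : PhyloTree n) (Ts : List (PhyloTree n)) →
    Σ (Fin (E T₁) → ℚ) λ x →
      (∀ e → 0ℚ ≤ x e) ×
      (∀ a b c d → Distinct4 a b c d → Displays T₁ a b c d →
        Any (λ Tᵢ → ¬ Displays Tᵢ a b c d) Ts →
        ∀ (es : List (Fin (E T₁))) → Unique es →
          (∀ e → (e ∈ es) ⇔ InL T₁ a b c d e) →
          1ℚ ≤ Σℚ (map x es)) ×
      (Σℚ (map x (allFin (E T₁))) ≡ (+ n) / 4)
lemma7 n T₁ Ts = weight , (λ e → quarter-mono-≤ {n = leafCount T₁ e} z≤n) , covers , total
  where
  weight : Fin (E T₁) → ℚ
  weight = quarter ∘ leafCount T₁

  Σweight : ∀ es → Σℚ (map weight es) ≡ quarter (sum (map (leafCount T₁) es))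
  Σweight es = trans (cong Σℚ (map-∘ es)) (Σℚ-map-quarter (map (leafCount T₁) es))

  total : Σℚ (map weight (allFin (E T₁))) ≡ (+ n) / 4
  total = trans (Σweight (allFin (E T₁))) (cong quarter (sum-leafCount T₁))

  -- Every quartet constraint holds, whether or not Q ∈ 𝒬.
  covers : ∀ a b c d → Distinct4 a b c d → Displays T₁ a b c d → Any (λ Tᵢ → ¬ Displays Tᵢ a b c d) Ts →
    ∀ es → Unique es → (∀ e → (e ∈ es) ⇔ InL T₁ a b c d e) → 1ℚ ≤ Σℚ (map weight es)
  covers a b c d distinct _ _ es _ es⇔L = ℚ.≤-trans
    (quarter-mono-≤ (quartet-leafCount T₁ es distinct (Equivalence.from (es⇔L _))))
    (ℚ.≤-reflexive (sym (Σweight es)))
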